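{- Let $q$ be a prime power and let $s,t,k$ be integers with $0\le s\le t\le k$. There exists a linear AOA$(s,t,k,q)$ if and only if there exists a linear MDS code of length $k$ and dimension $t$ over $\mathbb{F}_q$ which contains a linear MDS subcode of length $k$ and dimension $s$ over $\mathbb{F}_q$.
   Context: An orthogonal array OA$(t,k,v)$ is a $v^t\times k$ array with entries from a set $X$ of size $v$ such that the restriction to any $t$ columns contains every $t$-tuple of $X^t$ exactly once. An AOA$(s,t,k,v)$ is a $v^t\times (k+1)$ array $A$ such that: (1) the first $k$ columns form an OA$(t,k,v)$ on a set $X$ with $|X|=v$; (2) the last column has symbols from a set $Y$ with $|Y|=v^{t-s}$; (3) any $s$ of the first $k$ columns together with the last column contain every $(s+1)$-tuple of $X^s\times Y$ exactly once. A linear AOA$(s,t,k,q)$ is an AOA$(s,t,k,q)$ with $X=\mathbb{F}_q$ and $Y=\mathbb{F}_q^{t-s}$ such that the set of its rows, each regarded as a vector of $\mathbb{F}_q^{k+t-s}$ (the first $k$ entries followed by the $t-s$ coordinates of the last entry), is a $t$-dimensional $\mathbb{F}_q$-subspace. A linear MDS code of length $k$ and dimension $t$ over $\mathbb{F}_q$ is a $t$-dimensional subspace of $\mathbb{F}_q^k$ in which any two distinct vectors have Hamming distance at least $k-t+1$. -}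

module Defs where

open import Level using (0ℓ)
open import Data.Nat using (ℕ; zero; suc; _+_; _∸_; _^_; _≤_)
open import Data.Nat.Primality using (Prime)
open import Data.Fin using (Fin; zero; suc; splitAt)
open import Data.Sum using (_⊎_; inj₁; inj₂)
open import Data.Product using (Σ; ∃; _×_; _,_)
open import Relation.Nullary using (¬_; Dec; yes; no)
open import Relation.Binary.PropositionalEquality using (_≡_)
open import Function.Bundles using (_↔_)
open import Function.Definitions using (Injective)

IsPrimePower : ℕ → Set
IsPrimePower q = Σ ℕ λ p → Σ ℕ λ e → Prime p × (1 ≤ e) × (q ≡ p ^ e)

record FiniteField (q : ℕ) : Set₁ where
  infixl 6 _+F_
  infixl 7 _*F_
  field
    Carrier : Set
    _≟_     : (x y : Carrier) → Dec (x ≡ y)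
    _+F_ _*F_ : Carrier → Carrier → Carrier
    -F_     : Carrier → Carrier
    0F 1F   : Carrier
    _⁻¹     : Carrier → Carrier
    +-assoc : ∀ x y z → (x +F y) +F z ≡ x +F (y +F z)
    +-comm  : ∀ x y → x +F y ≡ y +F x
    +-identityˡ : ∀ x → 0F +F x ≡ x
    -‿inverseˡ  : ∀ x → (-F x) +F x ≡ 0F
    *-assoc : ∀ x y z → (x *F y) *F z ≡ x *F (y *F z)
    *-comm  : ∀ x y → x *F y ≡ y *F x
    *-identityˡ : ∀ x → 1F *F x ≡ x
    distribˡ : ∀ x y z → x *F (y +F z) ≡ (x *F y) +F (x *F z)
    0≢1     : ¬ (0F ≡ 1F)
    ⁻¹-inverseˡ : ∀ x → ¬ (x ≡ 0F) → (x ⁻¹) *F x ≡ 1F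
    size    : Fin q ↔ Carrier

module _ {q : ℕ} (F : FiniteField q) where
  open FiniteField F

  Vec : ℕ → Set
  Vec n = Fin n → Carrier

  _≈V_ : ∀ {n} → Vec n → Vec n → Set
  u ≈V v = ∀ i → u i ≡ v i

  zeroV : ∀ n → Vec n
  zeroV n i = 0F

  sumV : ∀ {n} → (Fin n → Carrier) → Carrier
  sumV {zero}  f = 0F
  sumV {suc n} f = f zero +F sumV (λ i → f (suc i))

  lincomb : ∀ {d n} → Vec d → (Fin d → Vec n) → Vec n
  lincomb c b i = sumV (λ j → c j *F b j i)

  IsSubspaceOfDim : ∀ {n} → ℕ → (Vec n → Set) → Set
  IsSubspaceOfDim {n} d S =
    Σ (Fin d → Vec n) λ b →
      ((∀ v → S v → Σ (Vec d) λ c → v ≈V lincomb c b)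
      × (∀ c v → v ≈V lincomb c b → S v))
      × (∀ c → lincomb c b ≈V zeroV n → c ≈V zeroV d)

  hamming : ∀ {n} → Vec n → Vec n → ℕ
  hamming {zero}  u v = 0
  hamming {suc n} u v with u zero ≟ v zero
  ... | yes _ = hamming (λ i → u (suc i)) (λ i → v (suc i))
  ... | no  _ = suc (hamming (λ i → u (suc i)) (λ i → v (suc i)))

  IsLinearMDS : (k t : ℕ) → (Vec k → Set) → Set
  IsLinearMDS k t C =
    IsSubspaceOfDim t C
    × (∀ u v → C u → C v → ¬ (u ≈V v) → k ∸ t + 1 ≤ hamming u v)

  MDSWithMDSSubcode : (s t k : ℕ) → Set₁
  MDSWithMDSSubcode s t k =
    Σ (Vec k → Set) λ C → Σ (Vec k → Set) λ D →
      IsLinearMDS k t C × IsLinearMDS k s D × (∀ v → D v → C v)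

  -- An array with q^t rows; row r has entries A r j ∈ F (j < k) in the
  -- first k columns and a last entry L r ∈ Y = F^(t-s).

  rowVec : ∀ {N k m} → (Fin N → Fin k → Carrier) → (Fin N → Vec m)
         → Fin N → Vec (k + m)
  rowVec {k = k} A L r j with splitAt k j
  ... | inj₁ a = A r a
  ... | inj₂ b = L r b

  record LinearAOA (s t k : ℕ) : Set₁ where
    field
      A : Fin (q ^ t) → Fin k → Carrier
      L : Fin (q ^ t) → Vec (t ∸ s)
      oa : (c : Fin t → Fin k) → Injective _≡_ _≡_ c → (x : Vec t) →
           Σ (Fin (q ^ t)) (λ r → ∀ i → A r (c i) ≡ x i)
           × (∀ r r′ → (∀ i → A r (c i) ≡ x i) → (∀ i → A r′ (c i) ≡ x i) → r ≡ r′)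
      aug : (c : Fin s → Fin k) → Injective _≡_ _≡_ c → (x : Vec s) → (y : Vec (t ∸ s)) →
            Σ (Fin (q ^ t)) (λ r → (∀ i → A r (c i) ≡ x i) × (L r ≈V y))
            × (∀ r r′ → ((∀ i → A r (c i) ≡ x i) × (L r ≈V y))
                      → ((∀ i → A r′ (c i) ≡ x i) × (L r′ ≈V y)) → r ≡ r′)
      S : Vec (k + (t ∸ s)) → Set
      S-dim : IsSubspaceOfDim t S
      rows⊆S : ∀ r → S (rowVec A L r)
      S⊆rows : ∀ v → S v → Σ (Fin (q ^ t)) λ r → rowVec A L r ≈V v

-- The first k columns of a linear AOA are the codewords of a t-dimensional code C, and the rows
-- whose last entry is 0 give an s-dimensional subcode D. The OA property says that a codeword of C
-- is determined by any t of its coordinates, the AOA property that a codeword of D is determined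
-- by any s of them, and being so determined is the MDS property.
--
-- Conversely, given D ⊆ C, index the rows by messages x ∈ F^t and write the codeword of x in the
-- first k columns. For the last column take a linear "syndrome" of x whose kernel is exactly the
-- set of messages with codeword in D: compare the codeword with the unique codeword of D agreeing
-- with it on s fixed positions, on t − s further positions. Then s columns together with the
-- syndrome determine the message, and since there are q^t rows, injectivity gives that every
-- value occurs exactly once.

module Submission where

open import Defs
open import Level using (0ℓ)
open import Algebra.Bundles using (CommutativeRing)
open import Algebra.Consequences.Propositional using (comm∧idˡ⇒id; comm∧invˡ⇒inv; comm∧distrˡ⇒distrʳ)
open import Data.Empty using (⊥-elim)
open import Data.Fin using (Fin; zero; suc; _↑ˡ_; _↑ʳ_; splitAt; inject≤; punchOut; finToFun; funToFin; combine)
  renaming (_≟_ to _≟ᶠ_)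
open import Data.Fin.Properties
  using (all?; any?; injective⇒≤; inject≤-injective; ↑ˡ-injective; punchOut-injective; suc-injective;
         join-splitAt; finToFun-funToFin; funToFin-finToFin)
open import Data.Nat using (ℕ; zero; suc; _+_; _∸_; _^_; _≤_; _<_; _≤?_)
import Data.Nat.Properties as ℕ
open import Data.Product using (Σ; _×_; _,_; proj₁; proj₂)
open import Data.Sum using (inj₁; inj₂)
open import Data.Sum.Properties using ([,]-∘)
open import Data.Vec.Functional using (tail; _++_; take; drop)
open import Data.Vec.Functional.Properties using (++-cong; lookup-++ˡ; lookup-++ʳ; ++-injectiveˡ; ++-injectiveʳ)
open import Function using (_∘_)
open import Function.Bundles using (Inverse; _⇔_; mk⇔)
open import Function.Definitions using (Injective)
open import Relation.Binary.Bundles using (Setoid)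
open import Relation.Binary.PropositionalEquality
  using (_≡_; _≢_; _≗_; refl; sym; trans; cong; cong₂; subst; isEquivalence; _→-setoid_; module ≡-Reasoning)
open import Relation.Nullary using (¬_; yes; no)

prefix : ∀ {m n} → m ≤ n → Fin m → Fin n
prefix m≤n i = inject≤ i m≤n

prefix-injective : ∀ {m n} (m≤n : m ≤ n) → Injective _≡_ _≡_ (prefix m≤n)
prefix-injective m≤n = inject≤-injective m≤n m≤n _ _

take++drop : ∀ {A : Set} {a b} (w : Fin (a + b) → A) → take a w ++ drop a w ≗ w
take++drop {a = a} {b} w j = trans (sym ([,]-∘ w (splitAt a j))) (cong w (join-splitAt a b j))

funToFin-cong : ∀ {m n} {f g : Fin m → Fin n} → (∀ i → f i ≡ g i) → funToFin f ≡ funToFin g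
funToFin-cong {zero}      f≗g = refl
funToFin-cong {suc m} {n} f≗g =
  cong₂ (combine {n = n ^ m}) (f≗g zero) (funToFin-cong (f≗g ∘ suc))

Fin-injective⇒surjective : ∀ {N} (g : Fin N → Fin N) → Injective _≡_ _≡_ g →
                           ∀ y → Σ (Fin N) λ r → g r ≡ y
Fin-injective⇒surjective {suc N} g g-injective y with any? (λ r → g r ≟ᶠ y)
... | yes hit = hit
... | no  miss = ⊥-elim (ℕ.1+n≰n (injective⇒≤ {f = λ r → punchOut (y≢g r)}
                   (λ eq → g-injective (punchOut-injective (y≢g _) (y≢g _) eq))))
  where
  y≢g : ∀ r → y ≢ g r
  y≢g r y≡gr = miss (r , sym y≡gr)

ExactlyOnce : ∀ {N} → (Fin N → Set) → Set
ExactlyOnce {N} P = Σ (Fin N) P × (∀ r r′ → P r → P r′ → r ≡ r′)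

ExactlyOnce-resp : ∀ {N} {P Q : Fin N → Set} →
                   (∀ r → P r → Q r) → (∀ r → Q r → P r) → ExactlyOnce P → ExactlyOnce Q
ExactlyOnce-resp P⇒Q Q⇒P ((r , Pr) , unique) =
  (r , P⇒Q r Pr) , λ r r′ Qr Qr′ → unique r r′ (Q⇒P r Qr) (Q⇒P r′ Qr′)

module _ {q : ℕ} (F : FiniteField q) where
  open FiniteField F

  F-commutativeRing : CommutativeRing 0ℓ 0ℓ
  F-commutativeRing = record
    { isCommutativeRing = record
      { isRing = record
        { +-isAbelianGroup = record
          { isGroup = record
            { isMonoid = record
              { isSemigroup = record
                { isMagma = record { isEquivalence = isEquivalence ; ∙-cong = cong₂ _+F_ }
                ; assoc = +-assoc }
              ; identity = comm∧idˡ⇒id +-comm +-identityˡ }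
            ; inverse = comm∧invˡ⇒inv +-comm -‿inverseˡ
            ; ⁻¹-cong = cong -F_ }
          ; comm = +-comm }
        ; *-cong = cong₂ _*F_
        ; *-assoc = *-assoc
        ; *-identity = comm∧idˡ⇒id *-comm *-identityˡ
        ; distrib = distribˡ , comm∧distrˡ⇒distrʳ *-comm distribˡ }
      ; *-comm = *-comm } }

  open CommutativeRing F-commutativeRing
    using (_-_; +-identityʳ; *-identityʳ; zeroˡ; zeroʳ; distribʳ; ring; semiring; +-commutativeSemigroup)
  open import Algebra.Properties.Ring ring
    using (-1*x≈-x; x∙y⁻¹≈ε⇒x≈y; x≈y⇒x∙y⁻¹≈ε; -‿+-comm; x[y-z]≈xy-xz)
  open import Algebra.Properties.CommutativeSemigroup +-commutativeSemigroup using (interchange)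
  open import Algebra.Properties.Semiring.Sum semiring
    using (sum; sum-cong-≋; sum-replicate-zero; ∑-distrib-+; *-distribˡ-sum)

  V : ℕ → Set
  V = Vec F

  infix 4 _≋_
  _≋_ : ∀ {n} → V n → V n → Set
  _≋_ = _≈V_ F

  module ≋ {n : ℕ} = Setoid (Fin n →-setoid Carrier)

  0V : ∀ n → V n
  0V = zeroV F

  infixl 6 _+V_ _-V_
  infixr 7 _·V_

  _+V_ : ∀ {n} → V n → V n → V n
  (u +V v) i = u i +F v i

  -V_ : ∀ {n} → V n → V n
  (-V u) i = -F u i

  _-V_ : ∀ {n} → V n → V n → V n
  (u -V v) i = u i - v i

  _·V_ : ∀ {n} → Carrier → V n → V n
  (α ·V u) i = α *F u i

  unit : ∀ {n} → Fin n → V n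
  unit zero    zero    = 1F
  unit zero    (suc j) = 0F
  unit (suc i) zero    = 0F
  unit (suc i) (suc j) = unit i j

  sumV≡sum : ∀ {n} (f : Fin n → Carrier) → sumV F f ≡ sum f
  sumV≡sum {zero}  f = refl
  sumV≡sum {suc n} f = cong (f zero +F_) (sumV≡sum (tail f))

  sumV-cong : ∀ {n} {f g : Fin n → Carrier} → (∀ i → f i ≡ g i) → sumV F f ≡ sumV F g
  sumV-cong {f = f} {g} f≗g = trans (sumV≡sum f) (trans (sum-cong-≋ f≗g) (sym (sumV≡sum g)))

  sumV-zero : ∀ {n} {f : Fin n → Carrier} → (∀ i → f i ≡ 0F) → sumV F f ≡ 0F
  sumV-zero {n} {f} f≗0 = trans (sumV≡sum f) (trans (sum-cong-≋ f≗0) (sum-replicate-zero n))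

  sumV-+ : ∀ {n} (f g : Fin n → Carrier) → sumV F (λ i → f i +F g i) ≡ sumV F f +F sumV F g
  sumV-+ f g = begin
    sumV F (λ i → f i +F g i)  ≡⟨ sumV≡sum (λ i → f i +F g i) ⟩
    sum (λ i → f i +F g i)     ≡⟨ ∑-distrib-+ f g ⟩
    sum f +F sum g             ≡⟨ sym (cong₂ _+F_ (sumV≡sum f) (sumV≡sum g)) ⟩
    sumV F f +F sumV F g       ∎
    where open ≡-Reasoning

  *-distribˡ-sumV : ∀ {n} α (f : Fin n → Carrier) →
                    α *F sumV F f ≡ sumV F (λ i → α *F f i)
  *-distribˡ-sumV α f = begin
    α *F sumV F f              ≡⟨ cong (α *F_) (sumV≡sum f) ⟩
    α *F sum f                 ≡⟨ *-distribˡ-sum α f ⟩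
    sum (λ i → α *F f i)       ≡⟨ sym (sumV≡sum (λ i → α *F f i)) ⟩
    sumV F (λ i → α *F f i)    ∎
    where open ≡-Reasoning

  lincomb-cong : ∀ {d n} {x y : V d} {b b′ : Fin d → V n} →
                 x ≋ y → (∀ j → b j ≋ b′ j) → lincomb F x b ≋ lincomb F y b′
  lincomb-cong x≋y b≋b′ i = sumV-cong (λ j → cong₂ _*F_ (x≋y j) (b≋b′ j i))

  lincomb-zeros : ∀ {d n} (x : V d) → lincomb F x (λ _ → 0V n) ≋ 0V n
  lincomb-zeros x i = sumV-zero (λ j → zeroʳ (x j))

  lincomb-unit : ∀ {n} (x : V n) → lincomb F x unit ≋ x
  lincomb-unit x zero =
    trans (cong₂ _+F_ (*-identityʳ (x zero)) (sumV-zero (λ i → zeroʳ (x (suc i))))) (+-identityʳ (x zero))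
  lincomb-unit x (suc j) = trans (cong₂ _+F_ (zeroʳ (x zero)) (lincomb-unit (tail x) j))
                                 (+-identityˡ (x (suc j)))

  lincomb-+ : ∀ {d n} (x y : V d) (b : Fin d → V n) →
              lincomb F (x +V y) b ≋ lincomb F x b +V lincomb F y b
  lincomb-+ x y b i = trans (sumV-cong (λ j → distribʳ (b j i) (x j) (y j)))
                            (sumV-+ (λ j → x j *F b j i) (λ j → y j *F b j i))

  lincomb-· : ∀ {d n} α (x : V d) (b : Fin d → V n) → lincomb F (α ·V x) b ≋ α ·V lincomb F x b
  lincomb-· α x b i = trans (sumV-cong (λ j → *-assoc α (x j) (b j i)))
                            (sym (*-distribˡ-sumV α (λ j → x j *F b j i)))

  -- Linear maps

  record IsLinear {a b : ℕ} (M : V a → V b) : Set where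
    field
      ≋-cong : ∀ {x y} → x ≋ y → M x ≋ M y
      +-homo : ∀ x y → M (x +V y) ≋ M x +V M y
      ·-homo : ∀ α x → M (α ·V x) ≋ α ·V M x

    0-homo : M (0V a) ≋ 0V b
    0-homo = ≋.trans (≋-cong (λ _ → sym (zeroˡ 0F)))
                     (≋.trans (·-homo 0F (0V a)) (λ i → zeroˡ (M (0V a) i)))

    -‿homo : ∀ x → M (-V x) ≋ -V M x
    -‿homo x = ≋.trans (≋-cong (λ i → sym (-1*x≈-x (x i))))
                       (≋.trans (·-homo (-F 1F) x) (λ i → -1*x≈-x (M x i)))

    −-homo : ∀ x y → M (x -V y) ≋ M x -V M y
    −-homo x y = ≋.trans (+-homo x (-V y)) (λ i → cong (M x i +F_) (-‿homo y i))

    lincomb-homo : ∀ {d} (x : V d) (w : Fin d → V a) → M (lincomb F x w) ≋ lincomb F x (M ∘ w)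
    lincomb-homo {zero}  x w = 0-homo
    lincomb-homo {suc d} x w =
      ≋.trans (+-homo (x zero ·V w zero) (lincomb F (tail x) (tail w)))
              (λ i → cong₂ _+F_ (·-homo (x zero) (w zero) i) (lincomb-homo (tail x) (tail w) i))

    ≋lincomb-unit-images : ∀ x → M x ≋ lincomb F x (M ∘ unit)
    ≋lincomb-unit-images x = ≋.trans (≋-cong (≋.sym (lincomb-unit x))) (lincomb-homo x unit)

    kernel-trivial⇒injective : (∀ x → M x ≋ 0V b → x ≋ 0V a) → Injective _≋_ _≋_ M
    kernel-trivial⇒injective ker {x} {y} Mx≋My i =
      x∙y⁻¹≈ε⇒x≈y (x i) (y i)
        (ker (x -V y) (≋.trans (−-homo x y) (λ j → x≈y⇒x∙y⁻¹≈ε (Mx≋My j))) i)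

  lincomb-isLinear : ∀ {d n} (b : Fin d → V n) → IsLinear (λ x → lincomb F x b)
  lincomb-isLinear b = record
    { ≋-cong = λ x≋y → lincomb-cong x≋y (λ _ _ → refl)
    ; +-homo = λ x y → lincomb-+ x y b
    ; ·-homo = λ α x → lincomb-· α x b
    }

  restriction-isLinear : ∀ {a b} (c : Fin b → Fin a) → IsLinear (λ (v : V a) → v ∘ c)
  restriction-isLinear c = record
    { ≋-cong = λ x≋y → x≋y ∘ c
    ; +-homo = λ _ _ _ → refl
    ; ·-homo = λ _ _ _ → refl
    }

  module _ {a b c : ℕ} {M : V b → V c} {N : V a → V b} (ML : IsLinear M) (NL : IsLinear N) where
    private
      module ML = IsLinear ML
      module NL = IsLinear NL

    ∘-isLinear : IsLinear (M ∘ N)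
    ∘-isLinear = record
      { ≋-cong = ML.≋-cong ∘ NL.≋-cong
      ; +-homo = λ x y → ≋.trans (ML.≋-cong (NL.+-homo x y)) (ML.+-homo (N x) (N y))
      ; ·-homo = λ α x → ≋.trans (ML.≋-cong (NL.·-homo α x)) (ML.·-homo α (N x))
      }

  module _ {a b : ℕ} {M N : V a → V b} (ML : IsLinear M) (NL : IsLinear N) where
    private
      module ML = IsLinear ML
      module NL = IsLinear NL

    difference-isLinear : IsLinear (λ x → M x -V N x)
    difference-isLinear = record
      { ≋-cong = λ x≋y i → cong₂ _-_ (ML.≋-cong x≋y i) (NL.≋-cong x≋y i)
      ; +-homo = λ x y i → begin
          M (x +V y) i - N (x +V y) i                    ≡⟨ cong₂ _-_ (ML.+-homo x y i) (NL.+-homo x y i) ⟩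
          (M x i +F M y i) +F (-F (N x i +F N y i))      ≡⟨ cong (M x i +F M y i +F_) (sym (-‿+-comm _ _)) ⟩
          (M x i +F M y i) +F ((-F N x i) +F (-F N y i)) ≡⟨ interchange (M x i) (M y i) _ _ ⟩
          (M x i - N x i) +F (M y i - N y i)             ∎
      ; ·-homo = λ α x i → trans (cong₂ _-_ (ML.·-homo α x i) (NL.·-homo α x i))
                                 (sym (x[y-z]≈xy-xz α (M x i) (N x i)))
      }
      where open ≡-Reasoning

  module _ {a b c : ℕ} {M : V a → V b} {N : V a → V c} (ML : IsLinear M) (NL : IsLinear N) where
    private
      module ML = IsLinear ML
      module NL = IsLinear NL

    ++-isLinear : IsLinear (λ x → M x ++ N x)
    ++-isLinear = record
      { ≋-cong = λ x≋y → ++-cong (M _) (M _) (ML.≋-cong x≋y) (NL.≋-cong x≋y)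
      ; +-homo = +-homo
      ; ·-homo = ·-homo
      }
      where
      +-homo : ∀ x y → M (x +V y) ++ N (x +V y) ≋ (M x ++ N x) +V (M y ++ N y)
      +-homo x y j with splitAt b j
      ... | inj₁ i = ML.+-homo x y i
      ... | inj₂ i = NL.+-homo x y i
      ·-homo : ∀ α x → M (α ·V x) ++ N (α ·V x) ≋ α ·V (M x ++ N x)
      ·-homo α x j with splitAt b j
      ... | inj₁ i = ML.·-homo α x i
      ... | inj₂ i = NL.·-homo α x i

  rightInverse-isLinear : ∀ {a b} {M : V a → V b} {N : V b → V a} →
    IsLinear M → Injective _≋_ _≋_ M → (∀ y → M (N y) ≋ y) → IsLinear N
  rightInverse-isLinear {M = M} {N} ML M-injective M∘N≋id = record
    { ≋-cong = λ {x} {y} x≋y →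
        M-injective (≋.trans (M∘N≋id x) (≋.trans x≋y (≋.sym (M∘N≋id y))))
    ; +-homo = λ x y → M-injective (≋.trans (M∘N≋id (x +V y))
        (≋.sym (≋.trans (+-homo (N x) (N y)) (λ i → cong₂ _+F_ (M∘N≋id x i) (M∘N≋id y i)))))
    ; ·-homo = λ α x → M-injective (≋.trans (M∘N≋id (α ·V x))
        (≋.sym (≋.trans (·-homo α (N x)) (λ i → cong (α *F_) (M∘N≋id x i)))))
    }
    where open IsLinear ML

  module Subspace {n d : ℕ} {S : V n → Set} (S-dim : IsSubspaceOfDim F d S) where
    basis : Fin d → V n
    basis = proj₁ S-dim

    spanned : ∀ v → S v → Σ (V d) λ c → v ≋ lincomb F c basis
    spanned = proj₁ (proj₁ (proj₂ S-dim))

    closed : ∀ c v → v ≋ lincomb F c basis → S v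
    closed = proj₂ (proj₁ (proj₂ S-dim))

    independent : ∀ c → lincomb F c basis ≋ 0V n → c ≋ 0V d
    independent = proj₂ (proj₂ S-dim)

    private
      module Coordinates = IsLinear (lincomb-isLinear basis)

    lincomb∈ : ∀ c → S (lincomb F c basis)
    lincomb∈ c = closed c _ ≋.refl

    ∈-resp-≋ : ∀ {u v} → S u → u ≋ v → S v
    ∈-resp-≋ {u} {v} u∈S u≋v = closed _ v (≋.trans (≋.sym u≋v) (proj₂ (spanned u u∈S)))

    0∈ : S (0V n)
    0∈ = closed (0V d) _ (≋.sym Coordinates.0-homo)

    lincomb-closed : ∀ {e} (x : V e) (w : Fin e → V n) → (∀ j → S (w j)) → S (lincomb F x w)
    lincomb-closed x w w∈S = closed (lincomb F x coordinates) _
      (≋.trans (lincomb-cong ≋.refl (λ j → proj₂ (spanned (w j) (w∈S j))))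
               (≋.sym (Coordinates.lincomb-homo x coordinates)))
      where
      coordinates : Fin _ → V d
      coordinates j = proj₁ (spanned (w j) (w∈S j))

    lincomb-injective : Injective _≋_ _≋_ (λ c → lincomb F c basis)
    lincomb-injective = Coordinates.kernel-trivial⇒injective independent

  -- Hamming distance and MDS codes

  agreements : ∀ {n} → V n → V n → ℕ
  agreements {zero}  u v = 0
  agreements {suc n} u v with u zero ≟ v zero
  ... | yes _ = suc (agreements (tail u) (tail v))
  ... | no  _ = agreements (tail u) (tail v)

  hamming+agreements≡length : ∀ {n} (u v : V n) → hamming F u v + agreements u v ≡ n
  hamming+agreements≡length {zero}  u v = refl
  hamming+agreements≡length {suc n} u v with u zero ≟ v zero
  ... | yes _ = trans (ℕ.+-suc _ _) (cong suc (hamming+agreements≡length (tail u) (tail v)))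
  ... | no  _ = cong suc (hamming+agreements≡length (tail u) (tail v))

  agreement : ∀ {n} (u v : V n) → Fin (agreements u v) → Fin n
  agreement {suc n} u v i       with u zero ≟ v zero
  agreement {suc n} u v zero    | yes _ = zero
  agreement {suc n} u v (suc i) | yes _ = suc (agreement (tail u) (tail v) i)
  agreement {suc n} u v i       | no  _ = suc (agreement (tail u) (tail v) i)

  agreement-agrees : ∀ {n} (u v : V n) i → u (agreement u v i) ≡ v (agreement u v i)
  agreement-agrees {suc n} u v i       with u zero ≟ v zero
  agreement-agrees {suc n} u v zero    | yes u₀≡v₀ = u₀≡v₀
  agreement-agrees {suc n} u v (suc i) | yes _     = agreement-agrees (tail u) (tail v) i
  agreement-agrees {suc n} u v i       | no  _     = agreement-agrees (tail u) (tail v) i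

  agreement-injective : ∀ {n} (u v : V n) → Injective _≡_ _≡_ (agreement u v)
  agreement-injective {suc n} u v {i} {j} eq with u zero ≟ v zero
  agreement-injective {suc n} u v {zero}  {zero}  eq | yes _ = refl
  agreement-injective {suc n} u v {suc i} {suc j} eq | yes _ =
    cong suc (agreement-injective (tail u) (tail v) (suc-injective eq))
  agreement-injective {suc n} u v {i}     {j}     eq | no  _ =
    agreement-injective (tail u) (tail v) (suc-injective eq)

  agreementIndex : ∀ {n} (u v : V n) j → u j ≡ v j → Fin (agreements u v)
  agreementIndex {suc n} u v j       uⱼ≡vⱼ with u zero ≟ v zero
  agreementIndex {suc n} u v zero    uⱼ≡vⱼ | yes _ = zero
  agreementIndex {suc n} u v (suc j) uⱼ≡vⱼ | yes _ =
    suc (agreementIndex (tail u) (tail v) j uⱼ≡vⱼ)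
  agreementIndex {suc n} u v zero    uⱼ≡vⱼ | no u₀≢v₀ = ⊥-elim (u₀≢v₀ uⱼ≡vⱼ)
  agreementIndex {suc n} u v (suc j) uⱼ≡vⱼ | no _ = agreementIndex (tail u) (tail v) j uⱼ≡vⱼ

  agreementIndex-injective : ∀ {n} (u v : V n) j j′ p p′ →
                             agreementIndex u v j p ≡ agreementIndex u v j′ p′ → j ≡ j′
  agreementIndex-injective {suc n} u v j j′ p p′ eq with u zero ≟ v zero
  agreementIndex-injective {suc n} u v zero    zero     p p′ eq | yes _ = refl
  agreementIndex-injective {suc n} u v (suc j) (suc j′) p p′ eq | yes _ =
    cong suc (agreementIndex-injective (tail u) (tail v) j j′ p p′ (suc-injective eq))
  agreementIndex-injective {suc n} u v zero    _        p p′ eq | no ¬p = ⊥-elim (¬p p)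
  agreementIndex-injective {suc n} u v (suc j) zero     p p′ eq | no ¬p = ⊥-elim (¬p p′)
  agreementIndex-injective {suc n} u v (suc j) (suc j′) p p′ eq | no _ =
    cong suc (agreementIndex-injective (tail u) (tail v) j j′ p p′ eq)

  agreeOn⇒hamming+m≤n : ∀ {n m} (u v : V n) (c : Fin m → Fin n) → Injective _≡_ _≡_ c →
                        u ∘ c ≋ v ∘ c → hamming F u v + m ≤ n
  agreeOn⇒hamming+m≤n u v c c-injective agree =
    subst (hamming F u v + _ ≤_) (hamming+agreements≡length u v)
      (ℕ.+-monoʳ-≤ (hamming F u v) (injective⇒≤ {f = λ i → agreementIndex u v (c i) (agree i)}
        (λ eq → c-injective (agreementIndex-injective u v _ _ (agree _) (agree _) eq))))

  hamming+m≤n⇒agreeOn : ∀ {n m} (u v : V n) → hamming F u v + m ≤ n →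
                        Σ (Fin m → Fin n) λ c → Injective _≡_ _≡_ c × (u ∘ c ≋ v ∘ c)
  hamming+m≤n⇒agreeOn {n} {m} u v h+m≤n =
    agreement u v ∘ inject≤′ ,
    (λ eq → inject≤-injective m≤agreements m≤agreements _ _ (agreement-injective u v eq)) ,
    agreement-agrees u v ∘ inject≤′
    where
    m≤agreements : m ≤ agreements u v
    m≤agreements = ℕ.+-cancelˡ-≤ (hamming F u v) m (agreements u v)
      (subst (hamming F u v + m ≤_) (sym (hamming+agreements≡length u v)) h+m≤n)
    inject≤′ : Fin m → Fin (agreements u v)
    inject≤′ i = inject≤ i m≤agreements

  MDSDistance : ∀ {n} → ℕ → (V n → Set) → Set
  MDSDistance {n} p C = ∀ u v → C u → C v → ¬ (u ≋ v) → n ∸ p + 1 ≤ hamming F u v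

  DeterminedBy : ∀ {n} → ℕ → (V n → Set) → Set
  DeterminedBy {n} m C = ∀ {u v} → C u → C v → (c : Fin m → Fin n) → Injective _≡_ _≡_ c →
                         u ∘ c ≋ v ∘ c → u ≋ v

  mds⇒determinedBy : ∀ {n p m} {C : V n → Set} → p ≤ m → MDSDistance p C → DeterminedBy m C
  mds⇒determinedBy {n} {p} {m} p≤m mds {u} {v} u∈C v∈C c c-injective agree
    with all? (λ i → u i ≟ v i)
  ... | yes u≋v = u≋v
  ... | no  u≉v = ⊥-elim (ℕ.<⇒≱ n∸p<h h≤n∸p)
    where
    n∸p<h : n ∸ p < hamming F u v
    n∸p<h = subst (_≤ hamming F u v) (ℕ.+-comm (n ∸ p) 1) (mds u v u∈C v∈C u≉v)
    h≤n∸p : hamming F u v ≤ n ∸ p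
    h≤n∸p = ℕ.≤-trans (ℕ.m+n≤o⇒m≤o∸n (hamming F u v) (agreeOn⇒hamming+m≤n u v c c-injective agree))
                      (ℕ.∸-monoʳ-≤ n p≤m)

  determinedBy⇒mds : ∀ {n p} {C : V n → Set} → p ≤ n → DeterminedBy p C → MDSDistance p C
  determinedBy⇒mds {n} {p} p≤n determined u v u∈C v∈C u≉v with n ∸ p + 1 ≤? hamming F u v
  ... | yes bound = bound
  ... | no  ¬bound =
    let c , c-injective , agree = hamming+m≤n⇒agreeOn u v (ℕ.m≤o∸n⇒m+n≤o (hamming F u v) p≤n h≤n∸p)
    in  ⊥-elim (u≉v (determined u∈C v∈C c c-injective agree))
    where
    h≤n∸p : hamming F u v ≤ n ∸ p
    h≤n∸p = ℕ.≤-pred (subst (suc (hamming F u v) ≤_) (ℕ.+-comm (n ∸ p) 1) (ℕ.≰⇒> ¬bound))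

  -- Counting

  private
    module Size = Inverse size

  encode : ∀ {n} → V n → Fin (q ^ n)
  encode x = funToFin (Size.from ∘ x)

  decode : ∀ {n} → Fin (q ^ n) → V n
  decode r = Size.to ∘ finToFun r

  decode-encode : ∀ {n} (x : V n) → decode (encode x) ≋ x
  decode-encode x i =
    trans (cong Size.to (finToFun-funToFin (Size.from ∘ x) i)) (Size.strictlyInverseˡ (x i))

  decode-injective : ∀ {n} → Injective _≡_ _≋_ (decode {n})
  decode-injective {n} {r} {r′} decode≋ = begin
    r                                ≡⟨ sym (funToFin-finToFin {n} {q} r) ⟩
    funToFin (finToFun {q} {n} r)    ≡⟨ funToFin-cong (λ i → trans (sym (Size.strictlyInverseʳ _))
                                          (trans (cong Size.from (decode≋ i)) (Size.strictlyInverseʳ _))) ⟩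
    funToFin (finToFun {q} {n} r′)   ≡⟨ funToFin-finToFin {n} {q} r′ ⟩
    r′                               ∎
    where open ≡-Reasoning

  injective⇒surjective : ∀ {a b} → a ≡ b → (f : V a → V b) → Injective _≋_ _≋_ f →
                         ∀ y → Σ (V a) λ x → f x ≋ y
  injective⇒surjective {a} refl f f-injective y =
    let r , f̂r≡ŷ = Fin-injective⇒surjective f̂ f̂-injective (encode y)
    in  decode r , ≋.trans (≋.sym (decode-encode (f (decode r))))
                           (≋.trans (decode-cong f̂r≡ŷ) (decode-encode y))
    where
    f̂ : Fin (q ^ a) → Fin (q ^ a)
    f̂ = encode ∘ f ∘ decode
    decode-cong : ∀ {r r′ : Fin (q ^ a)} → r ≡ r′ → decode {a} r ≋ decode r′
    decode-cong refl = ≋.refl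
    f̂-injective : Injective _≡_ _≡_ f̂
    f̂-injective {r} {r′} eq = decode-injective (f-injective
      (≋.trans (≋.sym (decode-encode (f (decode r))))
               (≋.trans (decode-cong eq) (decode-encode (f (decode r′))))))

  decode-exactlyOnce : ∀ {a b} → a ≡ b → (f : V a → V b) → (∀ {x y} → x ≋ y → f x ≋ f y) →
                       Injective _≋_ _≋_ f → ∀ y → ExactlyOnce (λ r → f (decode r) ≋ y)
  decode-exactlyOnce a≡b f f-cong f-injective y =
    let x , fx≋y = injective⇒surjective a≡b f f-injective y
    in  (encode x , ≋.trans (f-cong (decode-encode x)) fx≋y) ,
        λ r r′ fr≋y fr′≋y → decode-injective (f-injective (≋.trans fr≋y (≋.sym fr′≋y)))

  rowVec≋++ : ∀ {N k m} (A : Fin N → Fin k → Carrier) (L : Fin N → V m) r →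
              rowVec F A L r ≋ A r ++ L r
  rowVec≋++ {k = k} A L r j with splitAt k j
  ... | inj₁ _ = refl
  ... | inj₂ _ = refl

  lincomb-++ : ∀ {d a b} (x : V d) (u : Fin d → V a) (w : Fin d → V b) →
               lincomb F x (λ i → u i ++ w i) ≋ lincomb F x u ++ lincomb F x w
  lincomb-++ {a = a} x u w j with splitAt a j
  ... | inj₁ _ = refl
  ... | inj₂ _ = refl

  module FromAOA {s t k : ℕ} (s≤t : s ≤ t) (t≤k : t ≤ k) (aoa : LinearAOA F s t k) where
    open LinearAOA aoa
    private
      module Rows = Subspace S-dim

    m : ℕ
    m = t ∸ s

    row : Fin (q ^ t) → V (k + m)
    row = rowVec F A L

    take-row : ∀ r → take k (row r) ≋ A r
    take-row r a = trans (rowVec≋++ A L r (a ↑ˡ m)) (lookup-++ˡ (A r) (L r) a)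

    drop-row : ∀ r → drop k (row r) ≋ L r
    drop-row r j = trans (rowVec≋++ A L r (k ↑ʳ j)) (lookup-++ʳ (A r) (L r) j)

    rowOf : ∀ {v} → S v → Fin (q ^ t)
    rowOf {v} v∈S = proj₁ (S⊆rows v v∈S)

    row-rowOf : ∀ {v} (v∈S : S v) → row (rowOf v∈S) ≋ v
    row-rowOf {v} v∈S = proj₂ (S⊆rows v v∈S)

    A-rowOf : ∀ {v} (v∈S : S v) → A (rowOf v∈S) ≋ take k v
    A-rowOf v∈S = ≋.trans (≋.sym (take-row _)) (row-rowOf v∈S ∘ (_↑ˡ m))

    L-rowOf : ∀ {v} (v∈S : S v) → L (rowOf v∈S) ≋ drop k v
    L-rowOf v∈S = ≋.trans (≋.sym (drop-row _)) (row-rowOf v∈S ∘ (k ↑ʳ_))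

    sameRow : ∀ {u v r r′} → r ≡ r′ → u ≋ A r → v ≋ A r′ → u ≋ v
    sameRow refl u≋Ar v≋Ar = ≋.trans u≋Ar (≋.sym v≋Ar)

    A-injective : ∀ {r r′} → A r ≋ A r′ → r ≡ r′
    A-injective {r} {r′} Ar≋Ar′ =
      proj₂ (oa (prefix t≤k) (prefix-injective t≤k) (A r ∘ prefix t≤k)) r r′
        (λ _ → refl) (λ i → sym (Ar≋Ar′ (prefix t≤k i)))

    C : V k → Set
    C v = Σ (Fin (q ^ t)) λ r → v ≋ A r

    C-basis : Fin t → V k
    C-basis j = take k (Rows.basis j)

    C-dim : IsSubspaceOfDim F t C
    C-dim = C-basis , (spanned , closed) , independent
      where
      spanned : ∀ v → C v → Σ (V t) λ c → v ≋ lincomb F c C-basis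
      spanned v (r , v≋Ar) with Rows.spanned (row r) (rows⊆S r)
      ... | c , row≋ = c , ≋.trans v≋Ar (≋.trans (≋.sym (take-row r)) (row≋ ∘ (_↑ˡ m)))

      closed : ∀ c v → v ≋ lincomb F c C-basis → C v
      closed c v v≋ = rowOf (Rows.lincomb∈ c) , ≋.trans v≋ (≋.sym (A-rowOf (Rows.lincomb∈ c)))

      independent : ∀ c → lincomb F c C-basis ≋ 0V k → c ≋ 0V t
      independent c c≋0 = Rows.independent c λ j →
        trans (sym (row-rowOf c∈S j)) (trans (cong (λ r → row r j) sameRow₀) (row-rowOf Rows.0∈ j))
        where
        c∈S : S (lincomb F c Rows.basis)
        c∈S = Rows.lincomb∈ c
        sameRow₀ : rowOf c∈S ≡ rowOf Rows.0∈
        sameRow₀ = A-injective (≋.trans (A-rowOf c∈S) (≋.trans c≋0 (≋.sym (A-rowOf Rows.0∈))))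

    C-mds : MDSDistance t C
    C-mds = determinedBy⇒mds t≤k λ { (r , u≋Ar) (r′ , v≋Ar′) c c-injective agree →
      sameRow (proj₂ (oa c c-injective (A r ∘ c)) r r′ (λ _ → refl)
                     (≋.trans (≋.sym (v≋Ar′ ∘ c)) (≋.trans (≋.sym agree) (u≋Ar ∘ c))))
              u≋Ar v≋Ar′ }

    private
      s≤k : s ≤ k
      s≤k = ℕ.≤-trans s≤t t≤k

      ιₛ : Fin s → Fin k
      ιₛ = prefix s≤k

      unitRow-spec : ∀ i → Σ (Fin (q ^ t)) λ r → (A r ∘ ιₛ ≋ unit i) × (L r ≋ 0V m)
      unitRow-spec i = proj₁ (aug ιₛ (prefix-injective s≤k) (unit i) (0V m))

    unitRow : Fin s → Fin (q ^ t)
    unitRow i = proj₁ (unitRow-spec i)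

    D : V k → Set
    D v = Σ (Fin (q ^ t)) λ r → v ≋ A r × L r ≋ 0V m

    D-basis : Fin s → V k
    D-basis i = A (unitRow i)

    lincomb-D-basis-ιₛ : ∀ x → lincomb F x D-basis ∘ ιₛ ≋ x
    lincomb-D-basis-ιₛ x =
      ≋.trans (lincomb-cong ≋.refl (proj₁ ∘ proj₂ ∘ unitRow-spec)) (lincomb-unit x)

    combination : V s → Fin (q ^ t)
    combination x = rowOf (Rows.lincomb-closed x (row ∘ unitRow) (rows⊆S ∘ unitRow))

    combination-A : ∀ x → A (combination x) ≋ lincomb F x D-basis
    combination-A x = ≋.trans (A-rowOf _) (lincomb-cong ≋.refl (take-row ∘ unitRow))

    combination-L : ∀ x → L (combination x) ≋ 0V m
    combination-L x = ≋.trans (L-rowOf _)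
      (≋.trans (lincomb-cong ≋.refl λ i → ≋.trans (drop-row (unitRow i)) (proj₂ (proj₂ (unitRow-spec i))))
               (lincomb-zeros x))

    D-dim : IsSubspaceOfDim F s D
    D-dim = D-basis , (spanned , closed) , independent
      where
      spanned : ∀ v → D v → Σ (V s) λ c → v ≋ lincomb F c D-basis
      spanned v (r , v≋Ar , Lr≋0) =
        A r ∘ ιₛ , sameRow r≡combination v≋Ar (≋.sym (combination-A (A r ∘ ιₛ)))
        where
        r≡combination : r ≡ combination (A r ∘ ιₛ)
        r≡combination = proj₂ (aug ιₛ (prefix-injective s≤k) (A r ∘ ιₛ) (0V m)) r _
          (≋.refl , Lr≋0)
          (≋.trans (combination-A _ ∘ ιₛ) (lincomb-D-basis-ιₛ _) , combination-L _)

      closed : ∀ c v → v ≋ lincomb F c D-basis → D v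
      closed c v v≋ = combination c , ≋.trans v≋ (≋.sym (combination-A c)) , combination-L c

      independent : ∀ c → lincomb F c D-basis ≋ 0V k → c ≋ 0V s
      independent c c≋0 j = trans (sym (lincomb-D-basis-ιₛ c j)) (c≋0 (ιₛ j))

    D-mds : MDSDistance s D
    D-mds = determinedBy⇒mds s≤k λ { (r , u≋Ar , Lr≋0) (r′ , v≋Ar′ , Lr′≋0) c c-injective agree →
      sameRow (proj₂ (aug c c-injective (A r ∘ c) (0V m)) r r′ (≋.refl , Lr≋0)
                     ((≋.trans (≋.sym (v≋Ar′ ∘ c)) (≋.trans (≋.sym agree) (u≋Ar ∘ c))) , Lr′≋0))
              u≋Ar v≋Ar′ }

    codes : MDSWithMDSSubcode F s t k
    codes = C , D , (C-dim , C-mds) , (D-dim , D-mds) , λ { v (r , v≋Ar , _) → r , v≋Ar }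

  module ToAOA {s t k : ℕ} (s≤t : s ≤ t) (t≤k : t ≤ k) {C D : V k → Set}
               (C-mds : IsLinearMDS F k t C) (D-mds : IsLinearMDS F k s D)
               (D⊆C : ∀ v → D v → C v) where
    private
      module Code = Subspace (proj₁ C-mds)
      module Subcode = Subspace (proj₁ D-mds)

      D-determined : DeterminedBy s D
      D-determined = mds⇒determinedBy ℕ.≤-refl (proj₂ D-mds)

    m : ℕ
    m = t ∸ s

    s+m≡t : s + m ≡ t
    s+m≡t = ℕ.m+[n∸m]≡n s≤t

    s+m≤k : s + m ≤ k
    s+m≤k = subst (_≤ k) (sym s+m≡t) t≤k

    σ : Fin (s + m) → Fin k
    σ = prefix s+m≤k

    π : Fin s → Fin k
    π = σ ∘ (_↑ˡ m)

    τ : Fin m → Fin k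
    τ = σ ∘ (s ↑ʳ_)

    codeword : V t → V k
    codeword x = lincomb F x Code.basis

    codeword-isLinear : IsLinear codeword
    codeword-isLinear = lincomb-isLinear Code.basis

    subcodeHead : V s → V s
    subcodeHead y = lincomb F y Subcode.basis ∘ π

    subcodeHead-isLinear : IsLinear subcodeHead
    subcodeHead-isLinear = ∘-isLinear (restriction-isLinear π) (lincomb-isLinear Subcode.basis)

    subcodeHead-injective : Injective _≋_ _≋_ subcodeHead
    subcodeHead-injective head≋ = Subcode.lincomb-injective
      (D-determined (Subcode.lincomb∈ _) (Subcode.lincomb∈ _) π
         (λ eq → ↑ˡ-injective m _ _ (prefix-injective s+m≤k eq)) head≋)

    subcodeHead⁻¹ : V s → V s
    subcodeHead⁻¹ y = proj₁ (injective⇒surjective refl subcodeHead subcodeHead-injective y)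

    subcodeHead-inverse : ∀ y → subcodeHead (subcodeHead⁻¹ y) ≋ y
    subcodeHead-inverse y = proj₂ (injective⇒surjective refl subcodeHead subcodeHead-injective y)

    -- the codeword of D that agrees with codeword x on the positions π
    subcodeMatch : V t → V k
    subcodeMatch x = lincomb F (subcodeHead⁻¹ (codeword x ∘ π)) Subcode.basis

    subcodeMatch-isLinear : IsLinear subcodeMatch
    subcodeMatch-isLinear = ∘-isLinear (lincomb-isLinear Subcode.basis)
      (∘-isLinear (rightInverse-isLinear subcodeHead-isLinear subcodeHead-injective subcodeHead-inverse)
                  (∘-isLinear (restriction-isLinear π) codeword-isLinear))

    syndrome₀ : V t → V m
    syndrome₀ x = (codeword x -V subcodeMatch x) ∘ τ

    -- syndrome₀ written as a linear combination, so that the rows of the array span a subspace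
    syndromeBasis : Fin t → V m
    syndromeBasis i = syndrome₀ (unit i)

    syndrome : V t → V m
    syndrome x = lincomb F x syndromeBasis

    syndrome≋syndrome₀ : ∀ x → syndrome x ≋ syndrome₀ x
    syndrome≋syndrome₀ x = ≋.sym (IsLinear.≋lincomb-unit-images syndrome₀-isLinear x)
      where
      syndrome₀-isLinear : IsLinear syndrome₀
      syndrome₀-isLinear = ∘-isLinear (restriction-isLinear τ)
                                      (difference-isLinear codeword-isLinear subcodeMatch-isLinear)

    syndrome-kernel : ∀ x → syndrome x ≋ 0V m → D (codeword x)
    syndrome-kernel x syndrome≋0 =
      Subcode.∈-resp-≋ (Subcode.lincomb∈ (subcodeHead⁻¹ (codeword x ∘ π))) (≋.sym codeword≋match)
      where
      agreeOnτ : codeword x ∘ τ ≋ subcodeMatch x ∘ τ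
      agreeOnτ j = x∙y⁻¹≈ε⇒x≈y _ _ (trans (sym (syndrome≋syndrome₀ x j)) (syndrome≋0 j))
      agreeOnσ : codeword x ∘ σ ≋ subcodeMatch x ∘ σ
      agreeOnσ = ≋.trans (≋.sym (take++drop {a = s} (codeword x ∘ σ)))
                   (≋.trans (++-cong _ _ (≋.sym (subcodeHead-inverse (codeword x ∘ π))) agreeOnτ)
                            (take++drop {a = s} (subcodeMatch x ∘ σ)))
      codeword≋match : codeword x ≋ subcodeMatch x
      codeword≋match = mds⇒determinedBy (ℕ.≤-reflexive (sym s+m≡t)) (proj₂ C-mds)
        (Code.lincomb∈ x) (D⊆C _ (Subcode.lincomb∈ _)) σ (prefix-injective s+m≤k) agreeOnσ

    codewordOn-injective : (c : Fin t → Fin k) → Injective _≡_ _≡_ c →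
                           Injective _≋_ _≋_ (λ x → codeword x ∘ c)
    codewordOn-injective c c-injective agree = Code.lincomb-injective
      (mds⇒determinedBy ℕ.≤-refl (proj₂ C-mds) (Code.lincomb∈ _) (Code.lincomb∈ _) c c-injective agree)

    augmented : (Fin s → Fin k) → V t → V (s + m)
    augmented c z = (codeword z ∘ c) ++ syndrome z

    augmented-isLinear : ∀ c → IsLinear (augmented c)
    augmented-isLinear c = ++-isLinear (∘-isLinear (restriction-isLinear c) codeword-isLinear)
                                       (lincomb-isLinear syndromeBasis)

    augmented-injective : ∀ c → Injective _≡_ _≡_ c → Injective _≋_ _≋_ (augmented c)
    augmented-injective c c-injective = IsLinear.kernel-trivial⇒injective (augmented-isLinear c) kernel
      where
      kernel : ∀ z → augmented c z ≋ 0V (s + m) → z ≋ 0V t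
      kernel z aug≋0 = Code.independent z
        (D-determined (syndrome-kernel z syndrome≋0) Subcode.0∈ c c-injective codeword≋0)
        where
        syndrome≋0 : syndrome z ≋ 0V m
        syndrome≋0 j = trans (sym (lookup-++ʳ (codeword z ∘ c) (syndrome z) j)) (aug≋0 (s ↑ʳ j))
        codeword≋0 : codeword z ∘ c ≋ 0V s
        codeword≋0 i = trans (sym (lookup-++ˡ (codeword z ∘ c) (syndrome z) i)) (aug≋0 (i ↑ˡ m))

    A : Fin (q ^ t) → Fin k → Carrier
    A r = codeword (decode r)

    L : Fin (q ^ t) → V m
    L r = syndrome (decode r)

    B : Fin t → V (k + m)
    B i = Code.basis i ++ syndromeBasis i

    S : V (k + m) → Set
    S w = Σ (V t) λ x → w ≋ lincomb F x B

    row≋lincomb : ∀ r → rowVec F A L r ≋ lincomb F (decode r) B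
    row≋lincomb r = ≋.trans (rowVec≋++ A L r) (≋.sym (lincomb-++ (decode r) Code.basis syndromeBasis))

    S-dim : IsSubspaceOfDim F t S
    S-dim = B , ((λ _ w∈S → w∈S) , (λ c _ w≋ → c , w≋)) , independent
      where
      independent : ∀ c → lincomb F c B ≋ 0V (k + m) → c ≋ 0V t
      independent c c≋0 = Code.independent c λ a →
        trans (sym (lookup-++ˡ (codeword c) (syndrome c) a))
              (trans (sym (lincomb-++ c Code.basis syndromeBasis (a ↑ˡ m))) (c≋0 (a ↑ˡ m)))

    aoa : LinearAOA F s t k
    aoa = record
      { A = A
      ; L = L
      ; oa = λ c c-injective → decode-exactlyOnce refl (λ x → codeword x ∘ c)
               (λ x≋y → IsLinear.≋-cong codeword-isLinear x≋y ∘ c)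
               (codewordOn-injective c c-injective)
      ; aug = λ c c-injective x y → ExactlyOnce-resp
               (λ _ aug≋ → ++-injectiveˡ _ _ aug≋ , ++-injectiveʳ _ _ aug≋)
               (λ _ (A≋ , L≋) → ++-cong _ _ A≋ L≋)
               (decode-exactlyOnce (sym s+m≡t) (augmented c) (IsLinear.≋-cong (augmented-isLinear c))
                  (augmented-injective c c-injective) (x ++ y))
      ; S = S
      ; S-dim = S-dim
      ; rows⊆S = λ r → decode r , row≋lincomb r
      ; S⊆rows = λ w (x , w≋) → encode x ,
          ≋.trans (row≋lincomb (encode x))
                  (≋.trans (lincomb-cong (decode-encode x) (λ _ → ≋.refl)) (≋.sym w≋))
      }

theorem3p3 : (q : ℕ) → IsPrimePower q → (F : FiniteField q) →
    (s t k : ℕ) → s ≤ t → t ≤ k →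
    LinearAOA F s t k ⇔ MDSWithMDSSubcode F s t k
theorem3p3 q _ F s t k s≤t t≤k = mk⇔
  (FromAOA.codes F s≤t t≤k)
  (λ { (C , D , C-mds , D-mds , D⊆C) → ToAOA.aoa F s≤t t≤k C-mds D-mds D⊆C })
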